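{- Let $q\ge2$, $n\ge1$ and let $i$ be an integer with $0\le i\le n/2$. Then $$|\mathcal B(n,q)\cap X_i|=(q-1)^{n-i}\left({n\choose i}-{n\choose i-1}\right).$$
   Context: $(q)=\{0,\ldots,q-1\}$, $\mathbf x^{\mathbf v}=x_1^{v_1}\cdots x_n^{v_n}$. $\mathcal B(n,q)=\{\mathbf x^{\mathbf v}:\mathbf v\in(q)^n,\ |\{j\le 2t-1: v_j=q-1\}|\le t-1 \text{ for all positive integers } t\}$. $X_i=\{\mathbf x^{\mathbf u}:\mathbf u\in(q)^n,\ |\{j:u_j=q-1\}|=i\}$. Convention: ${n\choose -1}=0$. -}

module Defs where

open import Data.Nat using (ℕ; zero; suc; _+_; _*_; _∸_; _≤_; _≡ᵇ_)
open import Data.Nat.Combinatorics using (_C_)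
open import Data.Fin using (Fin; toℕ)
open import Data.Vec using (Vec; []; _∷_)
open import Data.Bool using (if_then_else_)
open import Relation.Binary.PropositionalEquality using (_≡_)

-- An exponent vector v ∈ (q)^n (monomial x^v) is a  Vec (Fin q) n ;
-- the j-th coordinate (j = 1..n) is the (j-1)-th entry of the vector.

topCount : (q : ℕ) → ℕ → ∀ {n} → Vec (Fin q) n → ℕ
topCount q zero    _        = 0
topCount q (suc m) []       = 0
topCount q (suc m) (x ∷ xs) = (if toℕ x ≡ᵇ (q ∸ 1) then 1 else 0) + topCount q m xs

InB : (q n : ℕ) → Vec (Fin q) n → Set
InB q n v = ∀ (t : ℕ) → 1 ≤ t → topCount q (2 * t ∸ 1) v ≤ t ∸ 1

InX : (q n i : ℕ) → Vec (Fin q) n → Set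
InX q n i v = topCount q n v ≡ i

-- binomial (n choose (i-1)) with the convention (n choose -1) = 0
binomPrev : ℕ → ℕ → ℕ
binomPrev n zero    = 0
binomPrev n (suc i) = n C i

module Submission where

-- Read a word from the left, letting each letter q − 1 spend one unit of a lead and each other
-- letter add one. Then x^v ∈ B(n,q) says exactly that 2·#{j ≤ p : v_j = q − 1} ≤ p for every
-- prefix length p, i.e. that the lead, starting at 0, never becomes negative. Splitting off the
-- first letter enumerates the words of length m with i letters q − 1 whose lead starts at d, and
-- their number (q − 1)^(m−i)·(C(m,i) − C(m,i−1−d)) (André's reflection principle for the ballot
-- problem) follows by induction on m from Pascal's rule.

open import Defs
open import Data.Nat using (ℕ; _+_; _*_; _∸_; _^_; _≤_)
open import Data.Nat.Combinatorics using (_C_)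
open import Data.Fin using (Fin)
open import Data.Vec using (Vec)
open import Data.List using (List; length)
open import Data.List.Membership.Propositional using (_∈_)
open import Data.List.Relation.Unary.Unique.Propositional using (Unique)
open import Data.Product using (Σ; _×_)
open import Function.Bundles using (_⇔_)
open import Relation.Binary.PropositionalEquality using (_≡_)

open import Data.Nat using (zero; suc; z≤n; s≤s)
open import Data.Nat.Combinatorics using (nCk+nC[k+1]≡[n+1]C[k+1]; k>n⇒nCk≡0)
open import Data.Nat.Properties
open import Algebra.Properties.CommutativeSemigroup +-commutativeSemigroup using (interchange)
open import Data.Fin using (toℕ; fromℕ; inject₁)
open import Data.Fin.Properties using (toℕ-fromℕ; toℕ-inject₁-≢; inject₁-injective; fromℕ≢inject₁)
open import Data.Fin.Relation.Unary.Top using (view; ‵fromℕ; ‵inject₁)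
open import Data.Vec using ([]; _∷_)
open import Data.Vec.Properties using (∷-injective)
open import Data.List using ([]; _∷_; [_]; map; _++_; allFin; cartesianProductWith)
open import Data.List.Properties using (length-map; length-++; length-tabulate)
open import Data.List.Membership.Propositional.Properties
  using (∈-map⁺; ∈-map⁻; ∈-++⁺ˡ; ∈-++⁺ʳ; ∈-++⁻; ∈-allFin; ∈-cartesianProductWith⁺; ∈-cartesianProductWith⁻)
open import Data.List.Relation.Unary.Any using (here)
import Data.List.Relation.Unary.Unique.Propositional.Properties as Unique
open import Data.List.Relation.Unary.AllPairs using ([]; _∷_)
open import Data.List.Relation.Unary.All using ([])
open import Data.Product using (∃-syntax; _,_; proj₂)
open import Data.Sum using (_⊎_; inj₁; inj₂)
open import Function using (_∘_)
open import Function.Bundles using (mk⇔; Equivalence)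
open import Relation.Binary.PropositionalEquality using (refl; sym; trans; cong; cong₂; subst; subst₂; module ≡-Reasoning)
open import Relation.Nullary.Decidable using (dec-true; dec-false)
open import Relation.Nullary.Negation using (¬_; contradiction)

length-cartesianProductWith : ∀ {a b c} {A : Set a} {B : Set b} {C : Set c}
  (f : A → B → C) (xs : List A) (ys : List B) →
  length (cartesianProductWith f xs ys) ≡ length xs * length ys
length-cartesianProductWith f []       ys = refl
length-cartesianProductWith f (x ∷ xs) ys = begin
  length (map (f x) ys ++ cartesianProductWith f xs ys)    ≡⟨ length-++ (map (f x) ys) ⟩
  length (map (f x) ys) + length (cartesianProductWith f xs ys)
    ≡⟨ cong₂ _+_ (length-map (f x) ys) (length-cartesianProductWith f xs ys) ⟩
  length ys + length xs * length ys                         ∎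
  where open ≡-Reasoning

-- reflectedC m i d = C(m, i − 1 − d), read as 0 when i ≤ d. By the reflection principle it
-- counts the placements of i top letters among m positions whose lead, starting from d,
-- drops below 0.
reflectedC : ℕ → ℕ → ℕ → ℕ
reflectedC m i       zero    = binomPrev m i
reflectedC m zero    (suc d) = 0
reflectedC m (suc i) (suc d) = reflectedC m i d

reflectedC-≤ : ∀ m {i d} → i ≤ d → reflectedC m i d ≡ 0
reflectedC-≤ m {zero}  {zero}  _         = refl
reflectedC-≤ m {zero}  {suc d} _         = refl
reflectedC-≤ m {suc i} {suc d} (s≤s i≤d) = reflectedC-≤ m i≤d

reflectedC-pascal : ∀ m i d → reflectedC (suc m) i d ≡ reflectedC m i (suc d) + reflectedC m i d
reflectedC-pascal m zero          zero    = refl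
reflectedC-pascal m (suc zero)    zero    = refl
reflectedC-pascal m (suc (suc i)) zero    = sym (nCk+nC[k+1]≡[n+1]C[k+1] m i)
reflectedC-pascal m zero          (suc d) = refl
reflectedC-pascal m (suc i)       (suc d) = reflectedC-pascal m i d

2*suc : ∀ n → 2 * suc n ≡ suc (suc (2 * n))
2*suc = *-suc 2

≤-half : ∀ c s → 2 * c ≤ suc (2 * s) → c ≤ s
≤-half c s 2c≤ = ≮⇒≥ λ s<c → <-irrefl refl (begin-strict
  suc (2 * s)  <⟨ n<1+n _ ⟩
  2 + 2 * s    ≡⟨ 2*suc s ⟨
  2 * suc s    ≤⟨ *-monoʳ-≤ 2 s<c ⟩
  2 * c        ≤⟨ 2c≤ ⟩
  suc (2 * s)  ∎)
  where open ≤-Reasoning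

even-or-odd : ∀ p → ∃[ s ] (p ≡ 2 * s ⊎ p ≡ suc (2 * s))
even-or-odd zero = 0 , inj₁ refl
even-or-odd (suc p) with even-or-odd p
... | s , inj₁ refl = s , inj₂ refl
... | s , inj₂ refl = suc s , inj₁ (sym (2*suc s))

-- Multiplying a + k^e b = k^e c by k raises the exponent e = m ∸ (1 + j) to m ∸ j,
-- except when truncation makes both exponents 0, where c = 0 forces a = b = 0.
*-raise-exponent : ∀ k m j {a b c} → (m ≤ j → c ≡ 0) →
  a + k ^ (m ∸ suc j) * b ≡ k ^ (m ∸ suc j) * c →
  k * a + k ^ (m ∸ j) * b ≡ k ^ (m ∸ j) * c
*-raise-exponent k zero j {a} c≡0 eq with refl ← c≡0 z≤n
  rewrite 0∸n≡0 j | m+n≡0⇒m≡0 a eq | *-zeroʳ k = m+n≡0⇒n≡0 a eq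
*-raise-exponent k (suc m) zero {a} {b} {c} _ eq = begin
  k * a + k * k ^ m * b    ≡⟨ cong (k * a +_) (*-assoc k (k ^ m) b) ⟩
  k * a + k * (k ^ m * b)  ≡⟨ *-distribˡ-+ k a _ ⟨
  k * (a + k ^ m * b)      ≡⟨ cong (k *_) eq ⟩
  k * (k ^ m * c)          ≡⟨ *-assoc k (k ^ m) c ⟨
  k * k ^ m * c            ∎
  where open ≡-Reasoning
*-raise-exponent k (suc m) (suc j) c≡0 eq = *-raise-exponent k m j (c≡0 ∘ s≤s) eq

-- Words over the alphabet Fin (1 + k); the top letter fromℕ k plays the role of q − 1.
module Ballots (k : ℕ) where

  Letter : Set
  Letter = Fin (suc k)

  top : Letter
  top = fromℕ k

  #top : ∀ {m} → ℕ → Vec Letter m → ℕ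
  #top p v = topCount (suc k) p v

  #top-inject₁ : ∀ p x {m} (xs : Vec Letter m) → #top (suc p) (inject₁ x ∷ xs) ≡ #top p xs
  #top-inject₁ p x xs
    rewrite dec-false (toℕ (inject₁ x) ≟ k) (toℕ-inject₁-≢ x ∘ sym) = refl

  #top-top : ∀ p {m} (xs : Vec Letter m) → #top (suc p) (top ∷ xs) ≡ suc (#top p xs)
  #top-top p xs rewrite dec-true (toℕ top ≟ k) (toℕ-fromℕ k) = refl

  #top-mono : ∀ {p p′ m} (v : Vec Letter m) → p ≤ p′ → #top p v ≤ #top p′ v
  #top-mono         v        z≤n          = z≤n
  #top-mono         []       (s≤s p≤p′)   = z≤n
  #top-mono         (x ∷ xs) (s≤s p≤p′) =
    +-monoʳ-≤ _ (#top-mono xs p≤p′)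

  data Ballot : ℕ → ∀ {m} → Vec Letter m → Set where
    []   : ∀ {d} → Ballot d []
    low  : ∀ {d m} (x : Fin k) {xs : Vec Letter m} → Ballot (suc d) xs → Ballot d (inject₁ x ∷ xs)
    high : ∀ {d m} {xs : Vec Letter m} → Ballot d xs → Ballot (suc d) (top ∷ xs)

  Ballot⇒prefix-bound : ∀ {d m} {v : Vec Letter m} → Ballot d v → ∀ p → 2 * #top p v ≤ d + p
  Ballot⇒prefix-bound []                zero    = z≤n
  Ballot⇒prefix-bound []                (suc p) = z≤n
  Ballot⇒prefix-bound (low x b)         zero    = z≤n
  Ballot⇒prefix-bound {d} (low x {xs} b) (suc p)
    rewrite #top-inject₁ p x xs | +-suc d p = Ballot⇒prefix-bound b p
  Ballot⇒prefix-bound (high b)          zero    = z≤n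
  Ballot⇒prefix-bound {suc d} (high {xs = xs} b) (suc p)
    rewrite #top-top p xs | 2*suc (#top p xs) | +-suc d p = s≤s (s≤s (Ballot⇒prefix-bound b p))

  prefix-bound⇒Ballot : ∀ d {m} (v : Vec Letter m) → (∀ p → 2 * #top p v ≤ d + p) → Ballot d v
  prefix-bound⇒Ballot d []       _ = []
  prefix-bound⇒Ballot d (x ∷ xs) bound with view x
  ... | ‵inject₁ y = low y (prefix-bound⇒Ballot (suc d) xs tail-bound)
    where
    tail-bound : ∀ p → 2 * #top p xs ≤ suc d + p
    tail-bound p with bound (suc p)
    ... | 2c≤ rewrite #top-inject₁ p y xs | +-suc d p = 2c≤
  prefix-bound⇒Ballot zero (.top ∷ xs) bound | ‵fromℕ =
    contradiction (subst (λ c → 2 * c ≤ 1) (#top-top 0 xs) (bound 1)) λ { (s≤s ()) }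
  prefix-bound⇒Ballot (suc d) (.top ∷ xs) bound | ‵fromℕ = high (prefix-bound⇒Ballot d xs tail-bound)
    where
    tail-bound : ∀ p → 2 * #top p xs ≤ d + p
    tail-bound p with bound (suc p)
    ... | 2c≤ rewrite #top-top p xs | 2*suc (#top p xs) | +-suc d p = ≤-pred (≤-pred 2c≤)

  odd-prefix : ∀ s → 2 * suc s ∸ 1 ≡ suc (2 * s)
  odd-prefix s = cong (_∸ 1) (2*suc s)

  InB⇒odd-prefix-bound : ∀ {n} {v : Vec Letter n} → InB (suc k) n v → ∀ s → #top (suc (2 * s)) v ≤ s
  InB⇒odd-prefix-bound {v = v} inB s = subst (λ p → #top p v ≤ s) (odd-prefix s) (inB (suc s) (s≤s z≤n))

  InB⇒prefix-bound : ∀ {n} {v : Vec Letter n} → InB (suc k) n v → ∀ p → 2 * #top p v ≤ p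
  InB⇒prefix-bound {v = v} inB p with even-or-odd p
  ... | s , inj₁ refl = *-monoʳ-≤ 2 (≤-trans (#top-mono v (n≤1+n _)) (InB⇒odd-prefix-bound inB s))
  ... | s , inj₂ refl = m≤n⇒m≤1+n (*-monoʳ-≤ 2 (InB⇒odd-prefix-bound inB s))

  prefix-bound⇒InB : ∀ {n} {v : Vec Letter n} → (∀ p → 2 * #top p v ≤ p) → InB (suc k) n v
  prefix-bound⇒InB {v = v} bound (suc s) _ =
    ≤-half _ s (subst (2 * #top (2 * suc s ∸ 1) v ≤_) (odd-prefix s) (bound (2 * suc s ∸ 1)))

  Ballot⇔InB : ∀ {n} (v : Vec Letter n) → Ballot 0 v ⇔ InB (suc k) n v
  Ballot⇔InB v = mk⇔ (prefix-bound⇒InB ∘ Ballot⇒prefix-bound)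
                     (prefix-bound⇒Ballot 0 v ∘ InB⇒prefix-bound)

  lows : List Letter
  lows = map inject₁ (allFin k)

  mutual
    ballots : (m i d : ℕ) → List (Vec Letter m)
    ballots zero    zero    d = [ [] ]
    ballots zero    (suc i) d = []
    ballots (suc m) i       d = cartesianProductWith _∷_ lows (ballots m i (suc d)) ++ topFirst m i d

    topFirst : (m i d : ℕ) → List (Vec Letter (suc m))
    topFirst m zero    d       = []
    topFirst m (suc i) zero    = []
    topFirst m (suc i) (suc d) = map (top ∷_) (ballots m i d)

  ∈-ballots⁺ : ∀ {d m} {v : Vec Letter m} → Ballot d v → v ∈ ballots m (#top m v) d
  ∈-ballots⁺ [] = here refl
  ∈-ballots⁺ {m = suc m} (low x {xs} b) rewrite #top-inject₁ m x xs =
    ∈-++⁺ˡ (∈-cartesianProductWith⁺ _∷_ (∈-map⁺ inject₁ (∈-allFin x)) (∈-ballots⁺ b))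
  ∈-ballots⁺ {m = suc m} (high {xs = xs} b) rewrite #top-top m xs =
    ∈-++⁺ʳ _ (∈-map⁺ (top ∷_) (∈-ballots⁺ b))

  ∈-ballots⁻ : ∀ m i d {v : Vec Letter m} → v ∈ ballots m i d → Ballot d v × #top m v ≡ i
  ∈-ballots⁻ zero zero d (here refl) = [] , refl
  ∈-ballots⁻ (suc m) i d v∈ with ∈-++⁻ (cartesianProductWith _∷_ lows (ballots m i (suc d))) v∈
  ... | inj₁ v∈lows
        with _ , xs , x∈ , xs∈ , refl ← ∈-cartesianProductWith⁻ _∷_ lows _ v∈lows
        with y , _ , refl ← ∈-map⁻ inject₁ x∈
        with b , refl ← ∈-ballots⁻ m i (suc d) xs∈
        = low y b , #top-inject₁ m y xs
  ∈-ballots⁻ (suc m) (suc i) (suc d) v∈ | inj₂ v∈top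
        with xs , xs∈ , refl ← ∈-map⁻ (top ∷_) v∈top
        with b , refl ← ∈-ballots⁻ m i d xs∈
        = high b , #top-top m xs

  topFirst-head : ∀ m i d {x} {xs : Vec Letter m} → x ∷ xs ∈ topFirst m i d → x ≡ top
  topFirst-head m (suc i) (suc d) x∷xs∈ with _ , _ , refl ← ∈-map⁻ (top ∷_) x∷xs∈ = refl

  mutual
    ballots-unique : ∀ m i d → Unique (ballots m i d)
    ballots-unique zero    zero    d = [] ∷ []
    ballots-unique zero    (suc i) d = []
    ballots-unique (suc m) i       d =
      Unique.++⁺ (Unique.cartesianProductWith⁺ _∷_ ∷-injective lows-unique (ballots-unique m i (suc d)))
                 (topFirst-unique m i d)
                 lows-topFirst-disjoint
      where
      lows-unique : Unique lows
      lows-unique = Unique.map⁺ inject₁-injective (Unique.allFin⁺ k)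

      lows-topFirst-disjoint : ∀ {v} → ¬ (v ∈ cartesianProductWith _∷_ lows (ballots m i (suc d)) × v ∈ topFirst m i d)
      lows-topFirst-disjoint (v∈lows , v∈top)
        with _ , _ , x∈ , _ , refl ← ∈-cartesianProductWith⁻ _∷_ lows _ v∈lows
        with y , _ , refl ← ∈-map⁻ inject₁ x∈
        = fromℕ≢inject₁ (sym (topFirst-head m i d v∈top))

    topFirst-unique : ∀ m i d → Unique (topFirst m i d)
    topFirst-unique m zero    d       = []
    topFirst-unique m (suc i) zero    = []
    topFirst-unique m (suc i) (suc d) = Unique.map⁺ (proj₂ ∘ ∷-injective) (ballots-unique m i d)

  length-ballots-suc : ∀ m i d →
    length (ballots (suc m) i d) ≡ k * length (ballots m i (suc d)) + length (topFirst m i d)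
  length-ballots-suc m i d = begin
    length (cartesianProductWith _∷_ lows (ballots m i (suc d)) ++ topFirst m i d)
      ≡⟨ length-++ (cartesianProductWith _∷_ lows (ballots m i (suc d))) ⟩
    length (cartesianProductWith _∷_ lows (ballots m i (suc d))) + length (topFirst m i d)
      ≡⟨ cong (_+ length (topFirst m i d)) (length-cartesianProductWith _∷_ lows (ballots m i (suc d))) ⟩
    length lows * length (ballots m i (suc d)) + length (topFirst m i d)
      ≡⟨ cong (λ l → l * length (ballots m i (suc d)) + length (topFirst m i d)) length-lows ⟩
    k * length (ballots m i (suc d)) + length (topFirst m i d)
      ∎
    where
    open ≡-Reasoning
    length-lows : length lows ≡ k
    length-lows = trans (length-map inject₁ (allFin k)) (length-tabulate _)

  length-ballots-no-top : ∀ m d → length (ballots m 0 d) ≡ k ^ m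
  length-ballots-no-top zero    d = refl
  length-ballots-no-top (suc m) d = begin
    length (ballots (suc m) 0 d)        ≡⟨ length-ballots-suc m 0 d ⟩
    k * length (ballots m 0 (suc d)) + 0 ≡⟨ +-identityʳ _ ⟩
    k * length (ballots m 0 (suc d))     ≡⟨ cong (k *_) (length-ballots-no-top m (suc d)) ⟩
    k * k ^ m                           ∎
    where open ≡-Reasoning

  -- Reflection counts the bad words exactly only if the final lead d + (m − i) − i is at
  -- least −1, which is the hypothesis.
  length-ballots-reflection : ∀ m i d → 2 * i ≤ suc (d + m) →
    length (ballots m i d) + k ^ (m ∸ i) * reflectedC m i d ≡ k ^ (m ∸ i) * (m C i)
  length-ballots-reflection m zero d _ rewrite reflectedC-≤ m {d = d} z≤n = begin
    length (ballots m 0 d) + k ^ m * 0 ≡⟨ cong₂ _+_ (length-ballots-no-top m d) (*-zeroʳ (k ^ m)) ⟩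
    k ^ m + 0                          ≡⟨ +-identityʳ (k ^ m) ⟩
    k ^ m                              ≡⟨ *-identityʳ (k ^ m) ⟨
    k ^ m * 1                          ∎
    where open ≡-Reasoning
  length-ballots-reflection zero (suc i) d 2i≤ = cong (_+ 0) (reflectedC-≤ 0 i<d)
    where
    i<d : suc i ≤ d
    i<d = ≤-pred (begin
      suc (suc i)       ≤⟨ s≤s (s≤s (m≤n*m i 2)) ⟩
      suc (suc (2 * i)) ≡⟨ 2*suc i ⟨
      2 * suc i         ≤⟨ 2i≤ ⟩
      suc (d + 0)       ≡⟨ cong suc (+-identityʳ d) ⟩
      suc d             ∎)
      where open ≤-Reasoning
  length-ballots-reflection (suc m) (suc j) d 2i≤ = begin
    length (ballots (suc m) (suc j) d) + K * reflectedC (suc m) (suc j) d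
      ≡⟨ cong₂ (λ l r → l + K * r) (length-ballots-suc m (suc j) d) (reflectedC-pascal m (suc j) d) ⟩
    (k * N₁ + T) + K * (R₁ + R₀)
      ≡⟨ cong (k * N₁ + T +_) (*-distribˡ-+ K R₁ R₀) ⟩
    (k * N₁ + T) + (K * R₁ + K * R₀)
      ≡⟨ interchange (k * N₁) T (K * R₁) (K * R₀) ⟩
    (k * N₁ + K * R₁) + (T + K * R₀)
      ≡⟨ cong₂ _+_ lows-first (tops-first d 2i≤) ⟩
    K * (m C suc j) + K * (m C j)
      ≡⟨ *-distribˡ-+ K (m C suc j) (m C j) ⟨
    K * (m C suc j + m C j)
      ≡⟨ cong (K *_) (trans (+-comm (m C suc j) (m C j)) (nCk+nC[k+1]≡[n+1]C[k+1] m j)) ⟩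
    K * (suc m C suc j)
      ∎
    where
    open ≡-Reasoning
    K  = k ^ (m ∸ j)
    N₁ = length (ballots m (suc j) (suc d))
    T  = length (topFirst m (suc j) d)
    R₁ = reflectedC m (suc j) (suc d)
    R₀ = reflectedC m (suc j) d

    lows-first : k * N₁ + K * R₁ ≡ K * (m C suc j)
    lows-first = *-raise-exponent k m j (λ m≤j → k>n⇒nCk≡0 (s≤s m≤j))
      (length-ballots-reflection m (suc j) (suc d) (subst (λ e → 2 * suc j ≤ suc e) (+-suc d m) 2i≤))

    tops-first : ∀ d′ → 2 * suc j ≤ suc (d′ + suc m) →
      length (topFirst m (suc j) d′) + K * reflectedC m (suc j) d′ ≡ K * (m C j)
    tops-first zero     _    = refl
    tops-first (suc d′) 2i≤′ = begin
      length (map (top ∷_) (ballots m j d′)) + K * reflectedC m j d′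
        ≡⟨ cong (_+ K * reflectedC m j d′) (length-map (top ∷_) (ballots m j d′)) ⟩
      length (ballots m j d′) + K * reflectedC m j d′
        ≡⟨ length-ballots-reflection m j d′ 2j≤ ⟩
      K * (m C j)
        ∎
      where
      2j≤ : 2 * j ≤ suc (d′ + m)
      2j≤ = ≤-pred (≤-pred (subst₂ _≤_ (2*suc j) (cong (suc ∘ suc) (+-suc d′ m)) 2i≤′))

  length-ballots : ∀ n i → 2 * i ≤ n → length (ballots n i 0) ≡ k ^ (n ∸ i) * (n C i ∸ binomPrev n i)
  length-ballots n i 2i≤n = begin
    length (ballots n i 0)
      ≡⟨ m+n∸n≡m (length (ballots n i 0)) (K * binomPrev n i) ⟨
    length (ballots n i 0) + K * binomPrev n i ∸ K * binomPrev n i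
      ≡⟨ cong (_∸ K * binomPrev n i) (length-ballots-reflection n i 0 (m≤n⇒m≤1+n 2i≤n)) ⟩
    K * (n C i) ∸ K * binomPrev n i
      ≡⟨ *-distribˡ-∸ K (n C i) (binomPrev n i) ⟨
    K * (n C i ∸ binomPrev n i)
      ∎
    where
    open ≡-Reasoning
    K = k ^ (n ∸ i)

  ∈-ballots⇔ : ∀ n i (v : Vec Letter n) → v ∈ ballots n i 0 ⇔ (InB (suc k) n v × InX (suc k) n i v)
  ∈-ballots⇔ n i v = mk⇔
    (λ v∈ → let b , #top≡i = ∈-ballots⁻ n i 0 v∈ in Equivalence.to (Ballot⇔InB v) b , #top≡i)
    (λ (inB , inX) → subst (λ j → v ∈ ballots n j 0) inX (∈-ballots⁺ (Equivalence.from (Ballot⇔InB v) inB)))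

-- The count holds for every q ≥ 1 and every n.
lemma12 : (q n i : ℕ) → 2 ≤ q → 1 ≤ n → 2 * i ≤ n →
    Σ (List (Vec (Fin q) n)) (λ L →
    Unique L
    × ((v : Vec (Fin q) n) → (v ∈ L) ⇔ (InB q n v × InX q n i v))
    × length L ≡ (q ∸ 1) ^ (n ∸ i) * (n C i ∸ binomPrev n i))
lemma12 zero    n i () _ _
lemma12 (suc k) n i _  _ 2i≤n =
  ballots n i 0 , ballots-unique n i 0 , ∈-ballots⇔ n i , length-ballots n i 2i≤n
  where open Ballots k
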